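{- Let $G=(V,E)$ be a connected finite graph in which every vertex carries a loop, with cyclomatic number $k$ (so that a spanning tree is obtained from $G$ by deleting $k$ non-loop edges), and let $T$ be an arbitrary spanning tree of $G$ (with all loops kept). Let $f$ be an optimal opinion function of $T$, and suppose that among the $k$ edges of $G$ deleted to obtain $T$, exactly $s$ join two vertices both having opinion $+1$ under $f$ and the remaining $l$ do not, where $l+s=k$. Then $$\gamma(T)-4k\le \gamma(G)\le \gamma(T)+2l.$$
   Context: All graphs are finite with vertex set $V$, $|V|=n$, and every vertex has a loop. For $v\in V$, the neighborhood $N_v=\{w\in V:(v,w)\in E\}$ contains $v$ itself. An opinion function is a map $f:V\to\{ -1,1\}$ (opinion $+1$ is "for", $-1$ is "against"), extended to subsets by $f(W)=\sum_{w\in W}f(w)$. A vertex $v$ votes "for" if $f(N_v)>0$; $V^+=\{v\in V: f(N_v)>0\}$. The opinion function $f$ is strictly majoritarian on the graph if $|V^+|>|V|/2$. The strict domination number is $\gamma(G)=\min\{f(V): f \text{ strictly majoritarian on } G\}$, and an opinion function of a graph is optimal if it is strictly majoritarian on that graph and $f(V)$ equals its strict domination number. The cyclomatic number of a connected graph is (number of non-loop edges) $-|V|+1$. -}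

module Defs where

open import Data.Nat as ℕ using (ℕ; zero; suc)
open import Data.Integer as ℤ using (ℤ; +_; -[1+_])
open import Data.Fin using (Fin; zero; suc; toℕ)
open import Data.Bool using (Bool; true; false; if_then_else_; _∧_; not)
open import Relation.Binary.PropositionalEquality using (_≡_)
open import Relation.Nullary.Decidable using (⌊_⌋)
open import Data.Product using (Σ; _×_; ∃)

Σℤ : ∀ {n} → (Fin n → ℤ) → ℤ
Σℤ {zero}  g = + 0
Σℤ {suc n} g = g zero ℤ.+ Σℤ (λ i → g (suc i))

count : ∀ {n} → (Fin n → Bool) → ℕ
count {zero}  p = 0
count {suc n} p = (if p zero then 1 else 0) ℕ.+ count (λ i → p (suc i))

Σℕ : ∀ {n} → (Fin n → ℕ) → ℕ
Σℕ {zero}  g = 0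
Σℕ {suc n} g = g zero ℕ.+ Σℕ (λ i → g (suc i))

countPairs : ∀ {n} → (Fin n → Fin n → Bool) → ℕ
countPairs p = Σℕ (λ i → count (λ j → ⌊ toℕ i ℕ.<? toℕ j ⌋ ∧ p i j))

record Graph (n : ℕ) : Set where
  field
    adj  : Fin n → Fin n → Bool
    sym  : ∀ u v → adj u v ≡ adj v u
    loop : ∀ v → adj v v ≡ true
open Graph public

edges : ∀ {n} → Graph n → ℕ
edges G = countPairs (adj G)

data Reach {n} (G : Graph n) : Fin n → Fin n → Set where
  here  : ∀ {u} → Reach G u u
  there : ∀ {u w v} → adj G u w ≡ true → Reach G w v → Reach G u v

Connected : ∀ {n} → Graph n → Set
Connected G = ∀ u v → Reach G u v

cyclomatic : ∀ {n} → Graph n → ℤ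
cyclomatic {n} G = + edges G ℤ.- + n ℤ.+ + 1

_⊆G_ : ∀ {n} → Graph n → Graph n → Set
T ⊆G G = ∀ u v → adj T u v ≡ true → adj G u v ≡ true

IsTree : ∀ {n} → Graph n → Set
IsTree {n} T = Connected T × (edges T ℕ.+ 1 ≡ n)

IsSpanningTree : ∀ {n} → Graph n → Graph n → Set
IsSpanningTree T G = T ⊆G G × IsTree T

-- opinion functions: true = +1 ("for"), false = -1 ("against")
Opinion : ℕ → Set
Opinion n = Fin n → Bool

val : Bool → ℤ
val true  = + 1
val false = -[1+ 0 ]

total : ∀ {n} → Opinion n → ℤ
total f = Σℤ (λ w → val (f w))

nbhdSum : ∀ {n} → Graph n → Opinion n → Fin n → ℤ
nbhdSum G f v = Σℤ (λ w → if adj G v w then val (f w) else + 0)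

votesFor : ∀ {n} → Graph n → Opinion n → ℕ
votesFor G f = count (λ v → ⌊ + 0 ℤ.<? nbhdSum G f v ⌋)

StrictlyMajoritarian : ∀ {n} → Graph n → Opinion n → Set
StrictlyMajoritarian {n} G f = n ℕ.< 2 ℕ.* votesFor G f

IsStrictDomNumber : ∀ {n} → Graph n → ℤ → Set
IsStrictDomNumber G g =
  (Σ (Opinion _) λ f → StrictlyMajoritarian G f × total f ≡ g) ×
  (∀ f → StrictlyMajoritarian G f → g ℤ.≤ total f)

Optimal : ∀ {n} → Graph n → Opinion n → Set
Optimal G f = StrictlyMajoritarian G f × IsStrictDomNumber G (total f)

{-# OPTIONS --safe #-}
module Submission where

-- Write G as the spanning tree T together with the set E of its k extra edges.
--
-- Lower bound: start from an optimal opinion on G and delete the extra edges one at a time.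
-- Deleting uv lowers neighbourhood sums only at u and v, and there by at most 1. A vertex whose
-- sum is still ≥ 0 votes "for" again once one of its "against" neighbours is switched to "for"
-- (if it has none, its sum is already positive). So each deletion costs at most 4 and keeps every
-- vote "for"; the final opinion is strictly majoritarian on T.
--
-- Upper bound: start from an optimal opinion f on T and add the extra edges one at a time. An
-- edge between two "for" vertices is free; otherwise an "against" endpoint is switched to "for",
-- at cost 2, and this can only happen for the l edges not joining two vertices with f = +1.
-- Invariant: a vertex x with an "against" neighbour across E was itself switched (gaining 2)
-- and has only one such neighbour (losing at most 1), so no vertex loses its vote.

open import Defs renaming (sym to adj-sym)
open import Data.Nat as ℕ using (ℕ; zero; suc)
import Data.Nat.Properties as ℕP
open import Data.Integer as ℤ using (ℤ; +_; -[1+_]; _+_; _-_; _*_; _≤_; _<_)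
import Data.Integer.Properties as ℤP
open import Data.Integer.Tactic.RingSolver using (solve-∀)
open import Algebra.Properties.CommutativeSemigroup ℕP.+-commutativeSemigroup
  using () renaming (interchange to +-interchange)
open import Data.Fin as Fin using (Fin; zero; suc; toℕ; _≟_)
import Data.Fin.Properties as FinP
open import Data.Bool as Bool using (Bool; true; false; if_then_else_; _∧_; _∨_; not; T)
import Data.Bool.Properties as BoolP
open import Data.Product using (Σ; ∃; ∃₂; _×_; _,_; proj₁; proj₂)
open import Data.Sum using (_⊎_; inj₁; inj₂)
open import Data.Vec.Functional using (updateAt)
open import Data.Vec.Functional.Properties using (updateAt-updates; updateAt-minimal)
open import Function using (_∘_; const; mk⇔)
open import Relation.Binary.PropositionalEquality
  using (_≡_; _≢_; refl; sym; trans; cong; cong₂; subst; subst₂; ≢-sym; module ≡-Reasoning)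
open import Relation.Nullary using (¬_; Dec; does; yes; no; contradiction)
open import Relation.Binary.Definitions using (tri<; tri≈; tri>)
open import Relation.Nullary.Decidable
  using (⌊_⌋; isYes≗does; _×-dec_; _⊎-dec_; dec-true; dec-false; does-⇔; toWitness; fromWitness)

-- Finite sums and pair counts

Σℤ-cong : ∀ {n} {a b : Fin n → ℤ} → (∀ w → a w ≡ b w) → Σℤ a ≡ Σℤ b
Σℤ-cong {zero}  a≗b = refl
Σℤ-cong {suc n} a≗b = cong₂ _+_ (a≗b zero) (Σℤ-cong (a≗b ∘ suc))

Σℤ-mono : ∀ {n} {a b : Fin n → ℤ} → (∀ w → a w ≤ b w) → Σℤ a ≤ Σℤ b
Σℤ-mono {zero}  a≤b = ℤP.≤-refl
Σℤ-mono {suc n} a≤b = ℤP.+-mono-≤ (a≤b zero) (Σℤ-mono (a≤b ∘ suc))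

Σℤ-zero : ∀ {n} → Σℤ {n} (const (+ 0)) ≡ + 0
Σℤ-zero {zero}  = refl
Σℤ-zero {suc n} = trans (ℤP.+-identityˡ _) (Σℤ-zero {n})

Σℤ-mono-except : ∀ {n} {a b : Fin n → ℤ} (p : Fin n) (c : ℤ) →
  (∀ w → w ≢ p → a w ≤ b w) → a p + c ≤ b p → Σℤ a + c ≤ Σℤ b
Σℤ-mono-except {suc n} {a} {b} zero c a≤b at-p =
  subst (_≤ Σℤ b) (swap-last (a zero) c (Σℤ (a ∘ suc)))
    (ℤP.+-mono-≤ at-p (Σℤ-mono (λ w → a≤b (suc w) λ ())))
  where
  swap-last : ∀ x y z → x + y + z ≡ x + z + y
  swap-last = solve-∀
Σℤ-mono-except {suc n} {a} {b} (suc p) c a≤b at-p =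
  subst (_≤ Σℤ b) (sym (ℤP.+-assoc (a zero) (Σℤ (a ∘ suc)) c))
    (ℤP.+-mono-≤ (a≤b zero λ ())
      (Σℤ-mono-except p c (λ w w≢p → a≤b (suc w) (w≢p ∘ FinP.suc-injective)) at-p))

Σℤ-mono-except₂ : ∀ {n} {a b : Fin n → ℤ} (p q : Fin n) → p ≢ q →
  (∀ w → w ≢ p → w ≢ q → a w ≤ b w) → a p + a q ≤ b p + b q → Σℤ a ≤ Σℤ b
Σℤ-mono-except₂ zero zero p≢q _ _ = contradiction refl p≢q
Σℤ-mono-except₂ {suc n} {a} {b} zero (suc q) _ a≤b at-pq =
  subst (_≤ Σℤ b) (shift (a zero) (b zero) (Σℤ (a ∘ suc)))
    (ℤP.+-monoʳ-≤ (b zero)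
      (Σℤ-mono-except q (a zero - b zero)
        (λ w w≢q → a≤b (suc w) (λ ()) (w≢q ∘ FinP.suc-injective))
        (subst₂ _≤_ (shift′ (a zero) (a (suc q)) (b zero)) (shift″ (b zero) (b (suc q)))
          (ℤP.+-monoʳ-≤ (ℤ.- b zero) at-pq))))
  where
  shift : ∀ x y z → y + (z + (x - y)) ≡ x + z
  shift = solve-∀
  shift′ : ∀ x y z → ℤ.- z + (x + y) ≡ y + (x - z)
  shift′ = solve-∀
  shift″ : ∀ x y → ℤ.- x + (x + y) ≡ y
  shift″ = solve-∀
Σℤ-mono-except₂ {a = a} {b} (suc p) zero p≢q a≤b at-pq =
  Σℤ-mono-except₂ zero (suc p) (≢-sym p≢q) (λ w w≢q w≢p → a≤b w w≢p w≢q)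
    (subst₂ _≤_ (ℤP.+-comm (a (suc p)) (a zero)) (ℤP.+-comm (b (suc p)) (b zero)) at-pq)
Σℤ-mono-except₂ (suc p) (suc q) p≢q a≤b at-pq =
  ℤP.+-mono-≤ (a≤b zero (λ ()) (λ ()))
    (Σℤ-mono-except₂ p q (p≢q ∘ cong suc)
      (λ w w≢p w≢q → a≤b (suc w) (w≢p ∘ FinP.suc-injective) (w≢q ∘ FinP.suc-injective)) at-pq)

-- Not Bool.toℕ: this form matches the clauses of count definitionally.
𝟙 : Bool → ℕ
𝟙 b = if b then 1 else 0

Σℕ-cong : ∀ {n} {a b : Fin n → ℕ} → (∀ i → a i ≡ b i) → Σℕ a ≡ Σℕ b
Σℕ-cong {zero}  a≗b = refl
Σℕ-cong {suc n} a≗b = cong₂ ℕ._+_ (a≗b zero) (Σℕ-cong (a≗b ∘ suc))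

Σℕ-+ : ∀ {n} (a b : Fin n → ℕ) → Σℕ (λ i → a i ℕ.+ b i) ≡ Σℕ a ℕ.+ Σℕ b
Σℕ-+ {zero}  a b = refl
Σℕ-+ {suc n} a b = begin
  a zero ℕ.+ b zero ℕ.+ Σℕ (λ i → a (suc i) ℕ.+ b (suc i))
    ≡⟨ cong (a zero ℕ.+ b zero ℕ.+_) (Σℕ-+ (a ∘ suc) (b ∘ suc)) ⟩
  a zero ℕ.+ b zero ℕ.+ (Σℕ (a ∘ suc) ℕ.+ Σℕ (b ∘ suc))
    ≡⟨ +-interchange (a zero) (b zero) (Σℕ (a ∘ suc)) (Σℕ (b ∘ suc)) ⟩
  a zero ℕ.+ Σℕ (a ∘ suc) ℕ.+ (b zero ℕ.+ Σℕ (b ∘ suc)) ∎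
  where open ≡-Reasoning

Σℕ-zero : ∀ {n} {a : Fin n → ℕ} → (∀ i → a i ≡ 0) → Σℕ a ≡ 0
Σℕ-zero {zero}  a≗0 = refl
Σℕ-zero {suc n} a≗0 = cong₂ ℕ._+_ (a≗0 zero) (Σℕ-zero (a≗0 ∘ suc))

Σℕ-single : ∀ {n} {a : Fin n → ℕ} (j : Fin n) → (∀ i → i ≢ j → a i ≡ 0) → Σℕ a ≡ a j
Σℕ-single {suc n} {a} zero a≗0 =
  trans (cong (a zero ℕ.+_) (Σℕ-zero (λ i → a≗0 (suc i) (λ ())))) (ℕP.+-identityʳ (a zero))
Σℕ-single {suc n} (suc j) a≗0 =
  cong₂ ℕ._+_ (a≗0 zero (λ ())) (Σℕ-single j (λ i i≢j → a≗0 (suc i) (i≢j ∘ FinP.suc-injective)))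

count-mono : ∀ {n} {p q : Fin n → Bool} → (∀ i → T (p i) → T (q i)) → count p ℕ.≤ count q
count-mono {zero}          p⇒q = ℕ.z≤n
count-mono {suc n} {p} {q} p⇒q with p zero | q zero | p⇒q zero
... | true  | true  | _ = ℕ.s≤s (count-mono (p⇒q ∘ suc))
... | true  | false | p0⇒q0 = contradiction (p0⇒q0 _) λ ()
... | false | true  | _ = ℕP.m≤n⇒m≤1+n (count-mono (p⇒q ∘ suc))
... | false | false | _ = count-mono (p⇒q ∘ suc)

count≡Σℕ : ∀ {n} (p : Fin n → Bool) → count p ≡ Σℕ (𝟙 ∘ p)
count≡Σℕ {zero}  p = refl
count≡Σℕ {suc n} p = cong (𝟙 (p zero) ℕ.+_) (count≡Σℕ (p ∘ suc))

isBefore : ∀ {n} → Fin n → Fin n → Bool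
isBefore i j = ⌊ toℕ i ℕ.<? toℕ j ⌋

isBefore-true : ∀ {n} {u v : Fin n} → u Fin.< v → isBefore u v ≡ true
isBefore-true {u = u} {v} u<v = trans (isYes≗does (toℕ u ℕ.<? toℕ v)) (dec-true (toℕ u ℕ.<? toℕ v) u<v)

pairTerm : ∀ {n} → (Fin n → Fin n → Bool) → Fin n → Fin n → ℕ
pairTerm p i j = 𝟙 (isBefore i j ∧ p i j)

countPairs≡ΣΣ : ∀ {n} (p : Fin n → Fin n → Bool) → countPairs p ≡ Σℕ (λ i → Σℕ (pairTerm p i))
countPairs≡ΣΣ p = Σℕ-cong (λ i → count≡Σℕ (λ j → isBefore i j ∧ p i j))

countPairs-cong : ∀ {n} {p q : Fin n → Fin n → Bool} → (∀ i j → p i j ≡ q i j) →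
  countPairs p ≡ countPairs q
countPairs-cong {p = p} {q} p≗q = begin
  countPairs p                   ≡⟨ countPairs≡ΣΣ p ⟩
  Σℕ (λ i → Σℕ (pairTerm p i))
    ≡⟨ Σℕ-cong (λ i → Σℕ-cong (λ j → cong (λ b → 𝟙 (isBefore i j ∧ b)) (p≗q i j))) ⟩
  Σℕ (λ i → Σℕ (pairTerm q i))    ≡⟨ countPairs≡ΣΣ q ⟨
  countPairs q                   ∎
  where open ≡-Reasoning

countPairs-split : ∀ {n} (p q r : Fin n → Fin n → Bool) →
  (∀ i j → 𝟙 (p i j) ≡ 𝟙 (q i j) ℕ.+ 𝟙 (r i j)) → countPairs p ≡ countPairs q ℕ.+ countPairs r
countPairs-split p q r p≡q+r = begin
  countPairs p                                                   ≡⟨ countPairs≡ΣΣ p ⟩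
  Σℕ (λ i → Σℕ (pairTerm p i))
    ≡⟨ Σℕ-cong (λ i → Σℕ-cong (λ j → guarded (isBefore i j) (p≡q+r i j))) ⟩
  Σℕ (λ i → Σℕ (λ j → pairTerm q i j ℕ.+ pairTerm r i j))
    ≡⟨ Σℕ-cong (λ i → Σℕ-+ (pairTerm q i) (pairTerm r i)) ⟩
  Σℕ (λ i → Σℕ (pairTerm q i) ℕ.+ Σℕ (pairTerm r i))
    ≡⟨ Σℕ-+ (λ i → Σℕ (pairTerm q i)) (λ i → Σℕ (pairTerm r i)) ⟩
  Σℕ (λ i → Σℕ (pairTerm q i)) ℕ.+ Σℕ (λ i → Σℕ (pairTerm r i))
    ≡⟨ cong₂ ℕ._+_ (countPairs≡ΣΣ q) (countPairs≡ΣΣ r) ⟨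
  countPairs q ℕ.+ countPairs r                                  ∎
  where
  open ≡-Reasoning
  guarded : ∀ b {x y z} → 𝟙 x ≡ 𝟙 y ℕ.+ 𝟙 z → 𝟙 (b ∧ x) ≡ 𝟙 (b ∧ y) ℕ.+ 𝟙 (b ∧ z)
  guarded true  e = e
  guarded false e = refl

countPairs-single : ∀ {n} (p : Fin n → Fin n → Bool) {u v : Fin n} → u Fin.< v →
  (∀ x w → x Fin.< w → ¬ (x ≡ u × w ≡ v) → p x w ≡ false) → countPairs p ≡ 𝟙 (p u v)
countPairs-single p {u} {v} u<v elsewhere = begin
  countPairs p                  ≡⟨ countPairs≡ΣΣ p ⟩
  Σℕ (λ i → Σℕ (pairTerm p i))   ≡⟨ Σℕ-single u (λ i i≢u → Σℕ-zero (λ j → vanishes i j (i≢u ∘ proj₁))) ⟩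
  Σℕ (pairTerm p u)              ≡⟨ Σℕ-single v (λ j j≢v → vanishes u j (j≢v ∘ proj₂)) ⟩
  pairTerm p u v                 ≡⟨ cong (λ b → 𝟙 (b ∧ p u v)) (isBefore-true u<v) ⟩
  𝟙 (p u v)                     ∎
  where
  open ≡-Reasoning
  vanishes : ∀ i j → ¬ (i ≡ u × j ≡ v) → pairTerm p i j ≡ 0
  vanishes i j ≢uv with toℕ i ℕ.<? toℕ j
  ... | yes i<j = cong 𝟙 (elsewhere i j i<j ≢uv)
  ... | no  _   = refl

-- Deleting one edge

Adj : ℕ → Set
Adj n = Fin n → Fin n → Bool

_∪_ : ∀ {n} → Adj n → Adj n → Adj n
(A ∪ B) x w = A x w ∨ B x w

Symmetric : ∀ {n} → Adj n → Set
Symmetric E = ∀ x w → E x w ≡ E w x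

Irreflexive : ∀ {n} → Adj n → Set
Irreflexive E = ∀ x → E x x ≡ false

Edgeless : ∀ {n} → Adj n → Set
Edgeless E = ∀ x w → E x w ≡ false

OnEdge : ∀ {n} → Fin n → Fin n → Fin n → Fin n → Set
OnEdge a b x w = (x ≡ a × w ≡ b) ⊎ (x ≡ b × w ≡ a)

onEdge? : ∀ {n} (a b x w : Fin n) → Dec (OnEdge a b x w)
onEdge? a b x w = (x ≟ a ×-dec w ≟ b) ⊎-dec (x ≟ b ×-dec w ≟ a)

OnEdge-swap : ∀ {n} {a b x w : Fin n} → OnEdge a b x w → OnEdge b a x w
OnEdge-swap (inj₁ on) = inj₂ on
OnEdge-swap (inj₂ on) = inj₁ on

OnEdge-reverse : ∀ {n} {a b x w : Fin n} → OnEdge a b x w → OnEdge a b w x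
OnEdge-reverse (inj₁ (x≡a , w≡b)) = inj₂ (w≡b , x≡a)
OnEdge-reverse (inj₂ (x≡b , w≡a)) = inj₁ (w≡a , x≡b)

record EdgeRemoved {n} (E E′ : Adj n) (a b : Fin n) : Set where
  field
    agree : ∀ x w → ¬ OnEdge a b x w → E′ x w ≡ E x w
    gone  : ∀ x w → OnEdge a b x w → E′ x w ≡ false

  split : ∀ {x w} → E x w ≡ true → E′ x w ≡ true ⊎ OnEdge a b x w
  split {x} {w} Exw with onEdge? a b x w
  ... | yes on  = inj₂ on
  ... | no  ¬on = inj₁ (trans (agree x w ¬on) Exw)

open EdgeRemoved

EdgeRemoved-swap : ∀ {n} {E E′ : Adj n} {a b} → EdgeRemoved E E′ a b → EdgeRemoved E E′ b a
EdgeRemoved-swap r = record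
  { agree = λ x w ¬on → agree r x w (¬on ∘ OnEdge-swap)
  ; gone  = λ x w on → gone r x w (OnEdge-swap on)
  }

EdgeRemoved-∪ˡ : ∀ {n} {E E′ : Adj n} {a b} (A : Adj n) → (∀ x w → OnEdge a b x w → A x w ≡ false) →
  EdgeRemoved E E′ a b → EdgeRemoved (A ∪ E) (A ∪ E′) a b
EdgeRemoved-∪ˡ A A-off r = record
  { agree = λ x w ¬on → cong (A x w ∨_) (agree r x w ¬on)
  ; gone  = λ x w on → cong₂ _∨_ (A-off x w on) (gone r x w on)
  }

EdgeRemoved-∧ʳ : ∀ {n} {E E′ : Adj n} {a b} (B : Adj n) →
  EdgeRemoved E E′ a b → EdgeRemoved (λ x w → E x w ∧ B x w) (λ x w → E′ x w ∧ B x w) a b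
EdgeRemoved-∧ʳ B r = record
  { agree = λ x w ¬on → cong (_∧ B x w) (agree r x w ¬on)
  ; gone  = λ x w on → cong (_∧ B x w) (gone r x w on)
  }

remove : ∀ {n} → Adj n → Fin n → Fin n → Adj n
remove E a b x w = E x w ∧ not (does (onEdge? a b x w))

remove-removes : ∀ {n} (E : Adj n) a b → EdgeRemoved E (remove E a b) a b
remove-removes E a b = record
  { agree = λ x w ¬on → trans (cong (λ o → E x w ∧ not o) (dec-false (onEdge? a b x w) ¬on))
                              (BoolP.∧-identityʳ (E x w))
  ; gone  = λ x w on → trans (cong (λ o → E x w ∧ not o) (dec-true (onEdge? a b x w) on))
                             (BoolP.∧-zeroʳ (E x w))
  }

remove-⊆ : ∀ {n} (E : Adj n) a b {x w} → remove E a b x w ≡ true → E x w ≡ true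
remove-⊆ E a b {x} {w} E′xw with E x w
... | true  = refl
... | false = E′xw

remove-symmetric : ∀ {n} (E : Adj n) a b → Symmetric E → Symmetric (remove E a b)
remove-symmetric E a b E-sym x w =
  cong₂ (λ e o → e ∧ not o) (E-sym x w)
    (does-⇔ (mk⇔ OnEdge-reverse OnEdge-reverse) (onEdge? a b x w) (onEdge? a b w x))

remove-irreflexive : ∀ {n} (E : Adj n) a b → Irreflexive E → Irreflexive (remove E a b)
remove-irreflexive E a b E-irr x = cong (λ e → e ∧ not (does (onEdge? a b x x))) (E-irr x)

countPairs-remove : ∀ {n} {E E′ : Adj n} {u v} → u Fin.< v → EdgeRemoved E E′ u v →
  countPairs E ≡ countPairs E′ ℕ.+ 𝟙 (E u v)
countPairs-remove {E = E} {E′} {u} {v} u<v r =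
  trans (countPairs-split E E′ onUV pointwise)
        (cong (countPairs E′ ℕ.+_) (trans (countPairs-single onUV u<v elsewhere) atUV))
  where
  onUV : Adj _
  onUV x w = does (onEdge? u v x w) ∧ E x w
  pointwise : ∀ x w → 𝟙 (E x w) ≡ 𝟙 (E′ x w) ℕ.+ 𝟙 (onUV x w)
  pointwise x w = by-cases (onEdge? u v x w)
    where
    by-cases : (on? : Dec (OnEdge u v x w)) → 𝟙 (E x w) ≡ 𝟙 (E′ x w) ℕ.+ 𝟙 (does on? ∧ E x w)
    by-cases (yes on)  rewrite gone r x w on = refl
    by-cases (no  ¬on) rewrite agree r x w ¬on = sym (ℕP.+-identityʳ _)
  elsewhere : ∀ x w → x Fin.< w → ¬ (x ≡ u × w ≡ v) → onUV x w ≡ false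
  elsewhere x w x<w ≢uv = by-cases (onEdge? u v x w)
    where
    by-cases : (on? : Dec (OnEdge u v x w)) → does on? ∧ E x w ≡ false
    by-cases (yes (inj₁ ≡uv))           = contradiction ≡uv ≢uv
    by-cases (yes (inj₂ (refl , refl))) = contradiction u<v (ℕP.<-asym x<w)
    by-cases (no  _)                    = refl
  atUV : 𝟙 (onUV u v) ≡ 𝟙 (E u v)
  atUV = cong (λ o → 𝟙 (o ∧ E u v)) (dec-true (onEdge? u v u v) (inj₁ (refl , refl)))

countPairs-remove-edge : ∀ {n} {E : Adj n} {u v} → u Fin.< v → E u v ≡ true →
  countPairs E ≡ suc (countPairs (remove E u v))
countPairs-remove-edge {E = E} {u} {v} u<v Euv = begin
  countPairs E                                  ≡⟨ countPairs-remove u<v (remove-removes E u v) ⟩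
  countPairs (remove E u v) ℕ.+ 𝟙 (E u v)       ≡⟨ cong (λ e → countPairs (remove E u v) ℕ.+ 𝟙 e) Euv ⟩
  countPairs (remove E u v) ℕ.+ 1               ≡⟨ ℕP.+-comm _ 1 ⟩
  suc (countPairs (remove E u v))               ∎
  where open ≡-Reasoning

orderedEdge? : ∀ {n} (E : Adj n) → Dec (∃₂ λ u v → u Fin.< v × E u v ≡ true)
orderedEdge? E = FinP.any? λ u → FinP.any? λ v → u FinP.<? v ×-dec E u v Bool.≟ true

edgeless : ∀ {n} {E : Adj n} → Symmetric E → Irreflexive E →
  ¬ (∃₂ λ u v → u Fin.< v × E u v ≡ true) → Edgeless E
edgeless {E = E} E-sym E-irr none x w with FinP.<-cmp x w
... | tri< x<w _ _    = BoolP.¬-not (λ Exw → none (x , w , x<w , Exw))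
... | tri≈ _ refl _   = E-irr x
... | tri> _ _ w<x    = trans (E-sym x w) (BoolP.¬-not (λ Ewx → none (w , x , w<x , Ewx)))

module _ {n} (P : Adj n → Set)
         (base : ∀ {E} → Edgeless E → P E)
         (step : ∀ {E u v} → u Fin.< v → E u v ≡ true → P (remove E u v) → P E) where

  removal-induction : ∀ E → Symmetric E → Irreflexive E → P E
  removal-induction E E-sym E-irr = go (countPairs E) E E-sym E-irr refl
    where
    go : ∀ m E → Symmetric E → Irreflexive E → countPairs E ≡ m → P E
    go m E E-sym E-irr #E with orderedEdge? E
    ... | no none = base (edgeless E-sym E-irr none)
    go zero E E-sym E-irr #E | yes (u , v , u<v , Euv)
      with () ← trans (sym #E) (countPairs-remove-edge u<v Euv)
    go (suc m) E E-sym E-irr #E | yes (u , v , u<v , Euv) =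
      step u<v Euv (go m (remove E u v) (remove-symmetric E u v E-sym) (remove-irreflexive E u v E-irr)
                       (ℕP.suc-injective (trans (sym (countPairs-remove-edge u<v Euv)) #E)))

-- Opinions and neighbourhood sums

_⊑_ : ∀ {n} → Opinion n → Opinion n → Set
f ⊑ g = ∀ x → f x ≡ true → g x ≡ true

⊑-refl : ∀ {n} {f : Opinion n} → f ⊑ f
⊑-refl x fx = fx

⊑-trans : ∀ {n} {f g h : Opinion n} → f ⊑ g → g ⊑ h → f ⊑ h
⊑-trans f⊑g g⊑h x = g⊑h x ∘ f⊑g x

⊑-against : ∀ {n} {f g : Opinion n} → f ⊑ g → ∀ {x} → g x ≡ false → f x ≡ false
⊑-against {f = f} f⊑g {x} gx with f x in fx
... | true  = trans (sym (f⊑g x fx)) gx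
... | false = refl

raise : ∀ {n} → Opinion n → Fin n → Opinion n
raise g a = updateAt g a (const true)

raise-at : ∀ {n} (g : Opinion n) a → raise g a a ≡ true
raise-at g a = updateAt-updates a g

raise-off : ∀ {n} (g : Opinion n) {a x} → x ≢ a → raise g a x ≡ g x
raise-off g {a} {x} = updateAt-minimal x a g

⊑-raise : ∀ {n} (g : Opinion n) a → g ⊑ raise g a
⊑-raise g a x gx with x ≟ a
... | yes refl = raise-at g a
... | no  x≢a  = trans (raise-off g x≢a) gx

raised-against : ∀ {n} (g : Opinion n) {a x} → raise g a x ≡ false → x ≢ a × g x ≡ false
raised-against g {a} {x} gx with x ≟ a
... | yes refl = contradiction (trans (sym (raise-at g a)) gx) λ ()
... | no  x≢a  = x≢a , trans (sym (raise-off g x≢a)) gx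

val-mono : ∀ {b c} → (b ≡ true → c ≡ true) → val b ≤ val c
val-mono {true}  {true}  _   = ℤP.≤-refl
val-mono {true}  {false} b⇒c = contradiction (b⇒c refl) λ ()
val-mono {false} {true}  _   = ℤ.-≤+
val-mono {false} {false} _   = ℤP.≤-refl

total-raise : ∀ {n} (g : Opinion n) {a} → g a ≡ false → total (raise g a) ≤ total g + + 2
total-raise g {a} ga = subst (_≤ total g + + 2) (cancel (total (raise g a)))
  (ℤP.+-monoˡ-≤ (+ 2)
    (Σℤ-mono-except a -[1+ 1 ]
      (λ w w≢a → ℤP.≤-reflexive (cong val (raise-off g w≢a)))
      (subst₂ (λ r o → val r + -[1+ 1 ] ≤ val o) (sym (raise-at g a)) (sym ga) ℤP.≤-refl)))
  where
  cancel : ∀ x → x + -[1+ 1 ] + + 2 ≡ x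
  cancel = solve-∀

adjSum : ∀ {n} → Adj n → Opinion n → Fin n → ℤ
adjSum A h x = Σℤ (λ w → if A x w then val (h w) else + 0)

adjSum-mono : ∀ {n} (A : Adj n) {f g : Opinion n} → f ⊑ g → ∀ x → adjSum A f x ≤ adjSum A g x
adjSum-mono A {f} {g} f⊑g x = Σℤ-mono pointwise
  where
  pointwise : ∀ w → (if A x w then val (f w) else + 0) ≤ (if A x w then val (g w) else + 0)
  pointwise w with A x w
  ... | true  = val-mono (f⊑g w)
  ... | false = ℤP.≤-refl

adjSum-cong : ∀ {n} (A B : Adj n) (h : Opinion n) x → (∀ w → A x w ≡ B x w) → adjSum A h x ≡ adjSum B h x
adjSum-cong A B h x A≗B = Σℤ-cong (λ w → cong (λ e → if e then val (h w) else + 0) (A≗B w))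

adjSum-drop : ∀ {n} (A A′ : Adj n) (h : Opinion n) x p →
  (∀ w → w ≢ p → A′ x w ≡ A x w) → A′ x p ≡ false → adjSum A h x + -[1+ 0 ] ≤ adjSum A′ h x
adjSum-drop A A′ h x p agree-off gone-p = Σℤ-mono-except p -[1+ 0 ] off at-p
  where
  off : ∀ w → w ≢ p → (if A x w then val (h w) else + 0) ≤ (if A′ x w then val (h w) else + 0)
  off w w≢p = ℤP.≤-reflexive (cong (λ e → if e then val (h w) else + 0) (sym (agree-off w w≢p)))
  at-p : (if A x p then val (h p) else + 0) + -[1+ 0 ] ≤ (if A′ x p then val (h p) else + 0)
  at-p rewrite gone-p with A x p | h p
  ... | true  | true  = ℤP.≤-refl
  ... | true  | false = ℤ.-≤+
  ... | false | _     = ℤ.-≤+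

votesFor-mono : ∀ {n} (G H : Graph n) {f g : Opinion n} →
  (∀ x → + 0 < nbhdSum G f x → + 0 < nbhdSum H g x) → votesFor G f ℕ.≤ votesFor H g
votesFor-mono G H votes = count-mono (λ x → fromWitness ∘ votes x ∘ toWitness)

strictlyMajoritarian-transfer : ∀ {n} (G H : Graph n) {f g : Opinion n} →
  (∀ x → + 0 < nbhdSum G f x → + 0 < nbhdSum H g x) →
  StrictlyMajoritarian G f → StrictlyMajoritarian H g
strictlyMajoritarian-transfer G H votes maj =
  ℕP.<-≤-trans maj (ℕP.*-monoʳ-≤ 2 (votesFor-mono G H votes))

-- Lower bound

secure-vote : ∀ {n} (A : Adj n) y → A y y ≡ true → (h : Opinion n) →
  Σ (Opinion n) λ h′ → h ⊑ h′ × total h′ ≤ total h + + 2 ×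
    (+ 0 ≤ adjSum A h y → + 0 < adjSum A h′ y)
secure-vote {n} A y Ayy h with FinP.any? (λ w → A y w Bool.≟ true ×-dec h w Bool.≟ false)
... | yes (w , Ayw , hw) = raise h w , ⊑-raise h w , total-raise h hw , λ 0≤ →
  ℤP.<-≤-trans (ℤP.<-≤-trans (ℤ.+<+ (ℕ.s≤s ℕ.z≤n)) (ℤP.+-monoˡ-≤ (+ 2) 0≤)) gain
  where
  gain : adjSum A h y + + 2 ≤ adjSum A (raise h w) y
  gain = Σℤ-mono-except w (+ 2)
    (λ w′ w′≢w → ℤP.≤-reflexive (cong (λ o → if A y w′ then val o else + 0) (sym (raise-off h w′≢w))))
    (subst₂ (λ e o → (if e then val (h w) else + 0) + + 2 ≤ (if e then val o else + 0))
      (sym Ayw) (sym (raise-at h w)) (subst (λ o → val o + + 2 ≤ + 1) (sym hw) ℤP.≤-refl))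
... | no none = h , ⊑-refl , ℤP.i≤i+j (total h) (+ 2) , λ _ → ℤP.suc[i]≤j⇒i<j all-for
  where
  nonneg : ∀ w → w ≢ y → + 0 ≤ (if A y w then val (h w) else + 0)
  nonneg w _ with A y w in Ayw | h w in hw
  ... | true  | true  = ℤ.+≤+ ℕ.z≤n
  ... | true  | false = contradiction (w , Ayw , hw) none
  ... | false | _     = ℤP.≤-refl
  self : + 0 + + 1 ≤ (if A y y then val (h y) else + 0)
  self rewrite Ayy with h y in hy
  ... | true  = ℤP.≤-refl
  ... | false = contradiction (y , Ayy , hy) none
  all-for : + 1 ≤ adjSum A h y
  all-for = subst (λ s → s + + 1 ≤ adjSum A h y) (Σℤ-zero {n})
    (Σℤ-mono-except {a = const (+ 0)} y (+ 1) nonneg self)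

removed-endpoint-nonneg : ∀ {n} (A A′ : Adj n) (h : Opinion n) x p →
  (∀ w → w ≢ p → A′ x w ≡ A x w) → A′ x p ≡ false → + 0 < adjSum A h x → + 0 ≤ adjSum A′ h x
removed-endpoint-nonneg A A′ h x p agree-off gone-p 0<s =
  ℤP.≤-trans (ℤP.+-monoˡ-≤ -[1+ 0 ] (ℤP.i<j⇒suc[i]≤j 0<s)) (adjSum-drop A A′ h x p agree-off gone-p)

repair-edge-removal : ∀ {n} {A A′ : Adj n} {u v} → u ≢ v → EdgeRemoved A A′ u v →
  A′ u u ≡ true → A′ v v ≡ true → (h : Opinion n) →
  Σ (Opinion n) λ h′ → total h′ ≤ total h + + 4 × (∀ x → + 0 < adjSum A h x → + 0 < adjSum A′ h′ x)
repair-edge-removal {A = A} {A′} {u} {v} u≢v removed A′uu A′vv h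
  with secure-vote A′ u A′uu h
... | h₁ , h⊑h₁ , total₁ , fix-u with secure-vote A′ v A′vv h₁
... | h₂ , h₁⊑h₂ , total₂ , fix-v = h₂ , total-h₂ , votes
  where
  total-h₂ : total h₂ ≤ total h + + 4
  total-h₂ = ℤP.≤-trans total₂
    (subst (total h₁ + + 2 ≤_) (ℤP.+-assoc (total h) (+ 2) (+ 2)) (ℤP.+-monoˡ-≤ (+ 2) total₁))
  votes : ∀ x → + 0 < adjSum A h x → + 0 < adjSum A′ h₂ x
  votes x 0<s with x ≟ u | x ≟ v
  ... | yes refl | _ =
    ℤP.<-≤-trans
      (fix-u (removed-endpoint-nonneg A A′ h u v
        (λ w w≢v → agree removed u w
          λ { (inj₁ (_ , w≡v)) → w≢v w≡v ; (inj₂ (u≡v , _)) → u≢v u≡v })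
        (gone removed u v (inj₁ (refl , refl))) 0<s))
      (adjSum-mono A′ h₁⊑h₂ u)
  ... | no _ | yes refl =
    fix-v (ℤP.≤-trans
      (removed-endpoint-nonneg A A′ h v u
        (λ w w≢u → agree removed v w
          λ { (inj₁ (v≡u , _)) → u≢v (sym v≡u) ; (inj₂ (_ , w≡u)) → w≢u w≡u })
        (gone removed v u (inj₂ (refl , refl))) 0<s)
      (adjSum-mono A′ h⊑h₁ v))
  ... | no x≢u | no x≢v =
    ℤP.<-≤-trans
      (subst (+ 0 <_) (adjSum-cong A A′ h x λ w → sym (agree removed x w
        λ { (inj₁ (x≡u , _)) → x≢u x≡u ; (inj₂ (x≡v , _)) → x≢v x≡v })) 0<s)
      (adjSum-mono A′ (⊑-trans h⊑h₁ h₁⊑h₂) x)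

repair-extra-edges : ∀ {n} (T : Adj n) → Symmetric T → (∀ x → T x x ≡ true) →
  ∀ E → Symmetric E → Irreflexive E → (∀ x w → E x w ≡ true → T x w ≡ false) →
  (h : Opinion n) → Σ (Opinion n) λ h′ → total h′ ≤ total h + + 4 * + countPairs E ×
    (∀ x → + 0 < adjSum (T ∪ E) h x → + 0 < adjSum T h′ x)
repair-extra-edges {n} T T-sym T-loop = removal-induction Repairable base step
  where
  Repairable : Adj n → Set
  Repairable E = (∀ x w → E x w ≡ true → T x w ≡ false) →
    (h : Opinion n) → Σ (Opinion n) λ h′ → total h′ ≤ total h + + 4 * + countPairs E ×
      (∀ x → + 0 < adjSum (T ∪ E) h x → + 0 < adjSum T h′ x)

  base : ∀ {E} → Edgeless E → Repairable E
  base {E} none _ h =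
    h , subst (λ c → total h ≤ total h + c) (ℤP.pos-* 4 (countPairs E)) (ℤP.i≤i+j _ _) , λ x →
    subst (+ 0 <_) (adjSum-cong (T ∪ E) T h x λ w →
      trans (cong (T x w ∨_) (none x w)) (BoolP.∨-identityʳ (T x w)))

  step : ∀ {E u v} → u Fin.< v → E u v ≡ true → Repairable (remove E u v) → Repairable E
  step {E} {u} {v} u<v Euv repair′ disjoint h =
    let h₁ , total₁ , votes₁ = repair-edge-removal (FinP.<⇒≢ u<v) removed
                                 (cong (_∨ _) (T-loop u)) (cong (_∨ _) (T-loop v)) h
        h₂ , total₂ , votes₂ = repair′ (λ x w → disjoint x w ∘ remove-⊆ E u v) h₁
    in h₂ , ℤP.≤-trans total₂ (cost h₁ total₁) , λ x → votes₂ x ∘ votes₁ x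
    where
    removed : EdgeRemoved (T ∪ E) (T ∪ remove E u v) u v
    removed = EdgeRemoved-∪ˡ T
      (λ { x w (inj₁ (refl , refl)) → disjoint u v Euv
         ; x w (inj₂ (refl , refl)) → trans (T-sym v u) (disjoint u v Euv) })
      (remove-removes E u v)
    c′ : ℕ
    c′ = countPairs (remove E u v)
    cost : ∀ h₁ → total h₁ ≤ total h + + 4 → total h₁ + + 4 * + c′ ≤ total h + + 4 * + countPairs E
    cost h₁ total₁ =
      subst (λ m → total h₁ + + 4 * + c′ ≤ total h + + 4 * + m) (sym (countPairs-remove-edge u<v Euv))
        (subst (total h₁ + + 4 * + c′ ≤_) (regroup (total h) (+ c′)) (ℤP.+-monoˡ-≤ (+ 4 * + c′) total₁))
      where
      regroup : ∀ x c → x + + 4 + + 4 * c ≡ x + + 4 * (+ 1 + c)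
      regroup = solve-∀

-- Upper bound

Compensated : ∀ {n} → Adj n → Opinion n → Opinion n → Set
Compensated E f g = ∀ x w → E x w ≡ true → g w ≡ false →
  f x ≡ false × g x ≡ true × (∀ w′ → E x w′ ≡ true → g w′ ≡ false → w′ ≡ w)

compensated-keep : ∀ {n} {E E′ : Adj n} {a b} {f g : Opinion n} → EdgeRemoved E E′ a b →
  g a ≡ true → g b ≡ true → Compensated E′ f g → Compensated E f g
compensated-keep {E = E} {E′} {a} {b} {f} {g} removed ga gb comp′ x w Exw gw =
  let fx , gx , unique = comp′ x w (kept Exw gw) gw
  in fx , gx , λ w′ Exw′ gw′ → unique w′ (kept Exw′ gw′) gw′
  where
  kept : ∀ {x w} → E x w ≡ true → g w ≡ false → E′ x w ≡ true
  kept Exw gw with split removed Exw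
  ... | inj₁ E′xw              = E′xw
  ... | inj₂ (inj₁ (_ , refl)) = contradiction (trans (sym gw) gb) λ ()
  ... | inj₂ (inj₂ (_ , refl)) = contradiction (trans (sym gw) ga) λ ()

compensated-raise : ∀ {n} {E E′ : Adj n} {a b} {f g : Opinion n} → a ≢ b → EdgeRemoved E E′ a b →
  f ⊑ g → Compensated E′ f g → g a ≡ false → Compensated E f (raise g a)
compensated-raise {E = E} {E′} {a} {b} {f} {g} a≢b removed f⊑g comp′ ga x w Exw g⁺w with x ≟ a
... | yes refl =
  ⊑-against f⊑g ga , raise-at g a ,
  λ w′ Eaw′ g⁺w′ → trans (towards-b Eaw′ g⁺w′) (sym (towards-b Exw g⁺w))
  where
  towards-b : ∀ {w} → E a w ≡ true → raise g a w ≡ false → w ≡ b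
  towards-b Eaw g⁺w with raised-against g g⁺w | split removed Eaw
  ... | _ , gw | inj₁ E′aw = contradiction (trans (sym ga) (proj₁ (proj₂ (comp′ a _ E′aw gw)))) λ ()
  ... | _      | inj₂ (inj₁ (_ , w≡b)) = w≡b
  ... | _      | inj₂ (inj₂ (a≡b , _)) = contradiction a≡b a≢b
... | no x≢a =
  let E′xw , gw = kept Exw g⁺w
      fx , gx , unique = comp′ x w E′xw gw
  in fx , trans (raise-off g x≢a) gx ,
     λ w′ Exw′ g⁺w′ → let E′xw′ , gw′ = kept Exw′ g⁺w′ in unique w′ E′xw′ gw′
  where
  kept : ∀ {w} → E x w ≡ true → raise g a w ≡ false → E′ x w ≡ true × g w ≡ false
  kept Exw g⁺w with raised-against g g⁺w | split removed Exw
  ... | _ , gw   | inj₁ E′xw              = E′xw , gw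
  ... | _        | inj₂ (inj₁ (x≡a , _)) = contradiction x≡a x≢a
  ... | w≢a , _  | inj₂ (inj₂ (_ , w≡a)) = contradiction w≡a w≢a

notBothFor : ∀ {n} → Adj n → Opinion n → Adj n
notBothFor E f x w = E x w ∧ not (f x ∧ f w)

compensate : ∀ {n} (f : Opinion n) E → Symmetric E → Irreflexive E →
  Σ (Opinion n) λ g → f ⊑ g × Compensated E f g × total g ≤ total f + + 2 * + countPairs (notBothFor E f)
compensate {n} f = removal-induction Compensable base step
  where
  Compensable : Adj n → Set
  Compensable E = Σ (Opinion n) λ g → f ⊑ g × Compensated E f g ×
    total g ≤ total f + + 2 * + countPairs (notBothFor E f)

  base : ∀ {E} → Edgeless E → Compensable E
  base {E} none =
    f , ⊑-refl , (λ x w Exw _ → contradiction (trans (sym Exw) (none x w)) λ ()) ,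
    subst (λ c → total f ≤ total f + c) (ℤP.pos-* 2 (countPairs (notBothFor E f))) (ℤP.i≤i+j _ _)

  step : ∀ {E u v} → u Fin.< v → E u v ≡ true → Compensable (remove E u v) → Compensable E
  step {E} {u} {v} u<v Euv (g′ , f⊑g′ , comp′ , total′) = by-endpoints (g′ u) (g′ v) refl refl
    where
    removed : EdgeRemoved E (remove E u v) u v
    removed = remove-removes E u v
    c′ : ℕ
    c′ = countPairs (notBothFor (remove E u v) f)
    #notBothFor : countPairs (notBothFor E f) ≡ c′ ℕ.+ 𝟙 (notBothFor E f u v)
    #notBothFor = countPairs-remove u<v (EdgeRemoved-∧ʳ (λ x w → not (f x ∧ f w)) removed)

    raising : ∀ {a b} → a ≢ b → EdgeRemoved E (remove E u v) a b → g′ a ≡ false →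
      notBothFor E f u v ≡ true → Compensable E
    raising {a} a≢b removed′ ga contested =
      raise g′ a , ⊑-trans f⊑g′ (⊑-raise g′ a) , compensated-raise a≢b removed′ f⊑g′ comp′ ga ,
      ℤP.≤-trans (total-raise g′ ga) (subst (total g′ + + 2 ≤_) more (ℤP.+-monoˡ-≤ (+ 2) total′))
      where
      regroup : ∀ x c → x + + 2 * c + + 2 ≡ x + + 2 * (c + + 1)
      regroup = solve-∀
      more : total f + + 2 * + c′ + + 2 ≡ total f + + 2 * + countPairs (notBothFor E f)
      more = begin
        total f + + 2 * + c′ + + 2                      ≡⟨ regroup (total f) (+ c′) ⟩
        total f + + 2 * (+ c′ + + 1)                    ≡⟨ cong (λ m → total f + + 2 * m) (ℤP.pos-+ c′ 1) ⟨
        total f + + 2 * + (c′ ℕ.+ 1)                    ≡⟨ cong (λ m → total f + + 2 * + m) one-more ⟨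
        total f + + 2 * + countPairs (notBothFor E f)   ∎
        where
        open ≡-Reasoning
        one-more : countPairs (notBothFor E f) ≡ c′ ℕ.+ 1
        one-more = trans #notBothFor (cong (λ b → c′ ℕ.+ 𝟙 b) contested)

    by-endpoints : ∀ bu bv → g′ u ≡ bu → g′ v ≡ bv → Compensable E
    by-endpoints true true gu gv = g′ , f⊑g′ , compensated-keep removed gu gv comp′ ,
      ℤP.≤-trans total′ (ℤP.+-monoʳ-≤ (total f) (ℤP.*-monoˡ-≤-nonNeg (+ 2) (ℤ.+≤+ fewer)))
      where
      fewer : c′ ℕ.≤ countPairs (notBothFor E f)
      fewer = subst (c′ ℕ.≤_) (sym #notBothFor) (ℕP.m≤m+n c′ _)
    by-endpoints false _ gu _ = raising (FinP.<⇒≢ u<v) removed gu contested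
      where
      contested : notBothFor E f u v ≡ true
      contested rewrite Euv | ⊑-against f⊑g′ gu = refl
    by-endpoints true false _ gv = raising (≢-sym (FinP.<⇒≢ u<v)) (EdgeRemoved-swap removed) gv contested
      where
      contested : notBothFor E f u v ≡ true
      contested rewrite Euv | ⊑-against f⊑g′ gv | BoolP.∧-zeroʳ (f u) = refl

adjSum-compensated : ∀ {n} (T E : Adj n) → (∀ x → T x x ≡ true) → {f g : Opinion n} →
  f ⊑ g → Compensated E f g → ∀ x → adjSum T f x ≤ adjSum (T ∪ E) g x
adjSum-compensated T E T-loop {f} {g} f⊑g comp x =
  by-cases (FinP.any? (λ w → E x w Bool.≟ true ×-dec g w Bool.≟ false))
  where
  weight-≤ : ∀ w → ¬ (E x w ≡ true × g w ≡ false) →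
    (if T x w then val (f w) else + 0) ≤ (if T x w ∨ E x w then val (g w) else + 0)
  weight-≤ w not-against with T x w
  ... | true  = val-mono (f⊑g w)
  ... | false with E x w | g w
  ...   | true  | true  = ℤ.+≤+ ℕ.z≤n
  ...   | true  | false = contradiction (refl , refl) not-against
  ...   | false | _     = ℤP.≤-refl

  by-cases : Dec (∃ λ w → E x w ≡ true × g w ≡ false) → adjSum T f x ≤ adjSum (T ∪ E) g x
  by-cases (no none) = Σℤ-mono (λ w → weight-≤ w (none ∘ (w ,_)))
  by-cases (yes (w₀ , Exw₀ , gw₀)) =
    Σℤ-mono-except₂ x w₀ (λ { refl → contradiction (trans (sym gx) gw₀) λ () })
      (λ w _ w≢w₀ → weight-≤ w λ (Exw , gw) → w≢w₀ (unique w Exw gw))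
      at-x-and-w₀
    where
    fx : f x ≡ false
    fx = proj₁ (comp x w₀ Exw₀ gw₀)
    gx : g x ≡ true
    gx = proj₁ (proj₂ (comp x w₀ Exw₀ gw₀))
    unique : ∀ w → E x w ≡ true → g w ≡ false → w ≡ w₀
    unique = proj₂ (proj₂ (comp x w₀ Exw₀ gw₀))
    at-x-and-w₀ :
      (if T x x then val (f x) else + 0) + (if T x w₀ then val (f w₀) else + 0) ≤
      (if T x x ∨ E x x then val (g x) else + 0) + (if T x w₀ ∨ E x w₀ then val (g w₀) else + 0)
    at-x-and-w₀ rewrite T-loop x | fx | gx | gw₀ | ⊑-against f⊑g gw₀ with T x w₀
    ... | true  = ℤ.-≤+
    ... | false rewrite Exw₀ = ℤ.-≤+

-- The spanning tree and its extra edges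

extraEdges : ∀ {n} → Graph n → Graph n → Adj n
extraEdges G T x w = adj G x w ∧ not (adj T x w)

extraEdges-symmetric : ∀ {n} (G T : Graph n) → Symmetric (extraEdges G T)
extraEdges-symmetric G T x w = cong₂ (λ g t → g ∧ not t) (adj-sym G x w) (adj-sym T x w)

extraEdges-irreflexive : ∀ {n} (G T : Graph n) → Irreflexive (extraEdges G T)
extraEdges-irreflexive G T x =
  trans (cong (λ t → adj G x x ∧ not t) (loop T x)) (BoolP.∧-zeroʳ (adj G x x))

extraEdges-disjoint : ∀ {n} (G T : Graph n) x w → extraEdges G T x w ≡ true → adj T x w ≡ false
extraEdges-disjoint G T x w extra with adj G x w | adj T x w
... | true  | false = refl
... | true  | true  = sym extra
... | false | _     = contradiction extra λ ()

adj-split : ∀ {n} (G T : Graph n) → T ⊆G G → ∀ x w → adj G x w ≡ (adj T ∪ extraEdges G T) x w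
adj-split G T T⊆G x w with adj T x w in Txw
... | true  = T⊆G x w Txw
... | false = sym (BoolP.∧-identityʳ (adj G x w))

cyclomatic-spanningTree : ∀ {n} (G T : Graph n) → IsSpanningTree T G →
  cyclomatic G ≡ + countPairs (extraEdges G T)
cyclomatic-spanningTree {n} G T (T⊆G , _ , #T) = begin
  + edges G - + n + + 1
    ≡⟨ cong₂ (λ e m → + e - + m + + 1) edges-split (sym #T) ⟩
  + (edges T ℕ.+ m) - + (edges T ℕ.+ 1) + + 1
    ≡⟨ cong₂ (λ e m → e - m + + 1) (ℤP.pos-+ (edges T) m) (ℤP.pos-+ (edges T) 1) ⟩
  + edges T + + m - (+ edges T + + 1) + + 1
    ≡⟨ cancel (+ edges T) (+ m) ⟩
  + m ∎
  where
  open ≡-Reasoning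
  m = countPairs (extraEdges G T)
  edges-split : edges G ≡ edges T ℕ.+ m
  edges-split = countPairs-split (adj G) (adj T) (extraEdges G T) pointwise
    where
    pointwise : ∀ x w → 𝟙 (adj G x w) ≡ 𝟙 (adj T x w) ℕ.+ 𝟙 (extraEdges G T x w)
    pointwise x w with adj T x w in Txw
    ... | true  rewrite T⊆G x w Txw = refl
    ... | false rewrite BoolP.∧-identityʳ (adj G x w) = refl
  cancel : ∀ e c → e + c - (e + + 1) + + 1 ≡ c
  cancel = solve-∀

i≤j+k⇒i-k≤j : ∀ {i j k} → i ≤ j + k → i - k ≤ j
i≤j+k⇒i-k≤j {i} {j} {k} i≤j+k = subst (i - k ≤_) (cancel j k) (ℤP.+-monoˡ-≤ (ℤ.- k) i≤j+k)
  where
  cancel : ∀ x y → x + y - y ≡ x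
  cancel = solve-∀

theorem1 : ∀ {n} (G T : Graph n) → Connected G → IsSpanningTree T G →
    (f : Opinion n) → Optimal T f →
    (k : ℤ) → k ≡ cyclomatic G →
    (s l : ℕ) →
    s ≡ countPairs (λ u v → adj G u v ∧ not (adj T u v) ∧ (f u ∧ f v)) →
    l ≡ countPairs (λ u v → adj G u v ∧ not (adj T u v) ∧ not (f u ∧ f v)) →
    (γG : ℤ) → IsStrictDomNumber G γG →
    (total f - + 4 * k ≤ γG) × (γG ≤ total f + + 2 * + l)
theorem1 {n} G T _ spanning@(T⊆G , _) f (T-maj , _ , γT-min) k k≡ _ l _ l≡ γG ((g₀ , G-maj , g₀≡γG) , γG-min) =
  lower-bound , upper-bound
  where
  E : Adj n
  E = extraEdges G T

  G≐T∪E : ∀ h x → adjSum (adj G) h x ≡ adjSum (adj T ∪ E) h x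
  G≐T∪E h x = adjSum-cong (adj G) (adj T ∪ E) h x (adj-split G T T⊆G x)

  lower-bound : total f - + 4 * k ≤ γG
  lower-bound =
    let h , cost , votes = repair-extra-edges (adj T) (adj-sym T) (loop T)
                             E (extraEdges-symmetric G T) (extraEdges-irreflexive G T) (extraEdges-disjoint G T) g₀
        f≤h = γT-min h (strictlyMajoritarian-transfer G T (λ x → votes x ∘ subst (+ 0 <_) (G≐T∪E g₀ x)) G-maj)
    in subst₂ (λ c γ → total f - + 4 * c ≤ γ) (sym (trans k≡ (cyclomatic-spanningTree G T spanning))) g₀≡γG
         (i≤j+k⇒i-k≤j (ℤP.≤-trans f≤h cost))

  upper-bound : γG ≤ total f + + 2 * + l
  upper-bound =
    let g , f⊑g , comp , cost = compensate f E (extraEdges-symmetric G T) (extraEdges-irreflexive G T)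
        votes x 0< = ℤP.<-≤-trans 0< (subst (adjSum (adj T) f x ≤_) (sym (G≐T∪E g x))
                       (adjSum-compensated (adj T) E (loop T) f⊑g comp x))
        γG≤g = γG-min g (strictlyMajoritarian-transfer T G votes T-maj)
    in ℤP.≤-trans γG≤g (subst (λ c → total g ≤ total f + + 2 * + c) (sym (trans l≡ #notBothFor)) cost)
    where
    #notBothFor : countPairs (λ u v → adj G u v ∧ not (adj T u v) ∧ not (f u ∧ f v)) ≡ countPairs (notBothFor E f)
    #notBothFor = countPairs-cong (λ u v → sym (BoolP.∧-assoc (adj G u v) (not (adj T u v)) (not (f u ∧ f v))))
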